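{- Let $\mathscr{T}$ be a finite tree with maximum degree $\Delta$. Then \[ \operatorname{FWI}^*(\mathscr{T})\ge \Delta(\Delta^2-1), \] with equality if and only if $\mathscr{T}$ is a path or $\mathscr{T}$ contains exactly one vertex of degree greater than $2$.
   Context: For a graph $G$ with vertex degrees $\deg(u)$, the modified Fibonacci word index is $\operatorname{FWI}^*(G)=\sum_{uv\in E(G)}\left|\deg(u)^2-\deg(v)^2\right|$, i.e. each edge contributes the square of the larger endpoint degree minus the square of the smaller one. The maximum degree is $\Delta(\mathscr{T})=\max\{\deg(v): v\in V(\mathscr{T})\}$. -}

module Defs where

open import Data.Nat using (ℕ; zero; suc; _+_; _*_; _∸_; _≤_; _<_; _<ᵇ_; _⊔_; ∣_-_∣)
open import Data.Bool using (Bool; true; false; if_then_else_)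
open import Data.Fin using (Fin; toℕ)
open import Data.List using (List; []; _∷_; _++_; [_]; length; map; foldr; allFin; concatMap)
open import Data.Nat.ListAction using (sum)
open import Data.List.Relation.Unary.Linked using (Linked)
open import Data.List.Relation.Unary.Unique.Propositional using (Unique)
open import Data.Product using (Σ; ∃; _×_; _,_)
open import Relation.Binary.PropositionalEquality using (_≡_)
open import Relation.Nullary using (¬_)
open import Function.Definitions using (Bijective)
open import Function.Bundles using (_⇔_)

record Graph (n : ℕ) : Set where
  field
    adj    : Fin n → Fin n → Bool
    sym    : ∀ u v → adj u v ≡ adj v u
    irrefl : ∀ v → adj v v ≡ false

open Graph public

module _ {n : ℕ} (G : Graph n) where

  Adj : Fin n → Fin n → Set
  Adj u v = adj G u v ≡ true

  deg : Fin n → ℕ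
  deg u = sum (map (λ v → if adj G u v then 1 else 0) (allFin n))

  -- maximum degree Δ (0 for the empty vertex set)
  Δ : ℕ
  Δ = foldr _⊔_ 0 (map deg (allFin n))

  -- contribution of an unordered pair {u,v} (counted once via toℕ u < toℕ v)
  pairTerm : Fin n → Fin n → ℕ
  pairTerm u v = if adj G u v
                 then (if toℕ u <ᵇ toℕ v
                       then ∣ deg u * deg u - deg v * deg v ∣ else 0)
                 else 0

  -- modified Fibonacci word index: sum over edges uv of |deg(u)^2 - deg(v)^2|
  FWI* : ℕ
  FWI* = sum (concatMap (λ u → map (pairTerm u) (allFin n)) (allFin n))

  data Walk : Fin n → Fin n → Set where
    here : ∀ {u} → Walk u u
    step : ∀ {u w v} → Adj u w → Walk w v → Walk u v

  Connected : Set
  Connected = ∀ u v → Walk u v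

  HasCycle : Set
  HasCycle = Σ (Fin n) λ v → Σ (List (Fin n)) λ vs →
    (2 ≤ length vs) × Unique (v ∷ vs) × Linked Adj (v ∷ vs ++ [ v ])

  IsTree : Set
  IsTree = (1 ≤ n) × Connected × ¬ HasCycle

  IsPath : Set
  IsPath = Σ (Fin n → Fin n) λ σ → Bijective _≡_ _≡_ σ ×
    (∀ i j → Adj (σ i) (σ j) ⇔ (∣ toℕ i - toℕ j ∣ ≡ 1))

  ExactlyOneBig : Set
  ExactlyOneBig = Σ (Fin n) λ v → (2 < deg v) × (∀ w → 2 < deg w → w ≡ v)

{-# OPTIONS --safe #-}
-- Let v have maximum degree Δ. Each neighbour u of v starts a non-backtracking walk v, u, … that
-- ends at a leaf; in a tree these legs are paths meeting only in v, so their edge sets are disjoint.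
-- Along a leg the terms ∣deg(a)² − deg(b)²∣ add up to at least deg(v)² − deg(leaf)² = Δ² − 1,
-- whence FWI* ≥ Δ(Δ² − 1). If all vertices other than v have degree at most 2, the legs are forced,
-- cover every edge, and degrees decrease along them, so the sum telescopes to equality. If some
-- w ≠ v has degree at least 3, let the leg through w leave it via one neighbour and add a branch
-- leaving w via another: it is edge-disjoint from all legs and adds at least deg(w)² − 1 > 0.
-- Trees of maximum degree at most 2 are exactly the paths.
module Submission where

open import Defs renaming (sym to adj-sym)
open import Data.Nat using (ℕ; zero; suc; _+_; _*_; _∸_; _≤_; _<_; _<ᵇ_; ∣_-_∣; z≤n; s≤s)
open import Data.Nat.Properties
open import Data.Nat.ListAction using (sum)
open import Data.Nat.ListAction.Properties using (sum-++)
open import Data.Bool using (true; false; if_then_else_)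
open import Data.Fin using (Fin; toℕ; cast) renaming (zero to fzero; suc to fsuc)
open import Data.Fin.Properties using (toℕ-injective; toℕ-cast; cast-involutive) renaming (_≟_ to _≟ᶠ_)
import Data.Bool.Properties as Bool
open import Data.List using (List; []; _∷_; _++_; [_]; length; map; allFin; concatMap; cartesianProduct; lookup)
open import Data.List.Properties using (map-++; map-∘; length-tabulate; foldr-preservesᵒ)
open import Data.List.Relation.Unary.All as All using (All; []; _∷_)
open import Data.List.Relation.Unary.All.Properties as All using ()
open import Data.List.Relation.Unary.Linked as Linked using (Linked; []; [-]; _∷_)
open import Data.List.Relation.Unary.AllPairs as AllPairs using ([]; _∷_)
import Data.List.Relation.Unary.AllPairs.Properties as AllPairs
open import Data.List.Relation.Unary.Unique.Propositional using (Unique)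
open import Data.List.Relation.Binary.Disjoint.Propositional using (Disjoint)
open import Data.List.Membership.Propositional using (_∈_; _∉_; lose)
open import Data.List.Membership.Propositional.Properties
  using (∈-∃++; ∈-++⁻; ∈-++⁺ˡ; ∈-++⁺ʳ; ∈-concatMap⁺; ∈-concatMap⁻; ∈-allFin; ∈-map⁺; ∈-map⁻; ∈-lookup;
         ∈-cartesianProduct⁺; foldr-selective)
open import Data.List.Relation.Unary.Unique.Propositional.Properties as Unique using (allFin⁺)
open import Data.List.Relation.Unary.Any as Any using (here; there; any?; satisfied)
open import Data.List.Relation.Unary.Any.Properties using (lookup-index)
open import Data.Product as Product using (Σ; ∃; ∃-syntax; ∃₂; _×_; _,_; proj₁; proj₂; swap)
open import Data.Product.Properties using (,-injective)
open import Data.Sum as Sum using (_⊎_; inj₁; inj₂)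
open import Data.Empty using (⊥-elim)
open import Relation.Nullary using (¬_; Dec; yes; no; ¬?; _×-dec_)
open import Function using (_∘′_; case_of_)
open import Function.Bundles using (_⇔_; mk⇔; Equivalence)
open import Function.Properties.Equivalence using () renaming (trans to ⇔-trans; sym to ⇔-sym)
open import Relation.Binary.PropositionalEquality
  using (_≡_; _≢_; refl; sym; trans; cong; cong₂; subst; subst₂; module ≡-Reasoning)

private variable
  A : Set
  x y z : A
  xs ys zs : List A

<ᵇ-asym : ∀ m n → (m <ᵇ n) ≡ true → (n <ᵇ m) ≡ false
<ᵇ-asym m       zero    ()
<ᵇ-asym zero    (suc n) _     = refl
<ᵇ-asym (suc m) (suc n) m<n   = <ᵇ-asym m n m<n

<ᵇ-flip : ∀ m n → (m <ᵇ n) ≡ false → m ≢ n → (n <ᵇ m) ≡ true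
<ᵇ-flip zero    zero    _   0≢0 = ⊥-elim (0≢0 refl)
<ᵇ-flip zero    (suc n) ()  _
<ᵇ-flip (suc m) zero    _   _   = refl
<ᵇ-flip (suc m) (suc n) m≮n m≢n = <ᵇ-flip m n m≮n (m≢n ∘′ cong suc)

∣m-n∣≡1⇔ : ∀ m n → ∣ m - n ∣ ≡ 1 ⇔ (n ≡ suc m ⊎ m ≡ suc n)
∣m-n∣≡1⇔ m n = mk⇔ (to m n) from
  where
  to : ∀ m n → ∣ m - n ∣ ≡ 1 → n ≡ suc m ⊎ m ≡ suc n
  to zero    n       d≡1 = inj₁ d≡1
  to (suc m) zero    d≡1 = inj₂ (cong suc (suc-injective d≡1))
  to (suc m) (suc n) d≡1 = Sum.map (cong suc) (cong suc) (to m n d≡1)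
  ∣n-1+n∣≡1 : ∀ n → ∣ n - suc n ∣ ≡ 1
  ∣n-1+n∣≡1 zero    = refl
  ∣n-1+n∣≡1 (suc n) = ∣n-1+n∣≡1 n
  from : ∀ {m n} → n ≡ suc m ⊎ m ≡ suc n → ∣ m - n ∣ ≡ 1
  from {m} (inj₁ refl) = ∣n-1+n∣≡1 m
  from {n = n} (inj₂ refl) = trans (∣-∣-comm (suc n) n) (∣n-1+n∣≡1 n)

-- Only two numbers lie at distance 1 from m.
distance-1-pigeonhole : ∀ {m a b c} → ∣ m - a ∣ ≡ 1 → ∣ m - b ∣ ≡ 1 → ∣ m - c ∣ ≡ 1 → a ≡ b ⊎ a ≡ c ⊎ b ≡ c
distance-1-pigeonhole {m} {a} {b} {c} da db dc
  with Equivalence.to (∣m-n∣≡1⇔ m a) da | Equivalence.to (∣m-n∣≡1⇔ m b) db | Equivalence.to (∣m-n∣≡1⇔ m c) dc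
... | inj₁ refl | inj₁ refl | _         = inj₁ refl
... | inj₂ ma   | inj₂ mb   | _         = inj₁ (suc-injective (trans (sym ma) mb))
... | inj₁ refl | inj₂ _    | inj₁ refl = inj₂ (inj₁ refl)
... | inj₁ _    | inj₂ mb   | inj₂ mc   = inj₂ (inj₂ (suc-injective (trans (sym mb) mc)))
... | inj₂ _    | inj₁ refl | inj₁ refl = inj₂ (inj₂ refl)
... | inj₂ ma   | inj₁ _    | inj₂ mc   = inj₂ (inj₁ (suc-injective (trans (sym ma) mc)))

∈-++-∷⁻ : ∀ xs → z ∈ xs ++ y ∷ ys → y ≢ z → z ∈ xs ++ ys
∈-++-∷⁻ []       (here refl) y≢z = ⊥-elim (y≢z refl)
∈-++-∷⁻ []       (there z∈)  _   = z∈
∈-++-∷⁻ (x ∷ xs) (here refl) _   = here refl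
∈-++-∷⁻ (x ∷ xs) (there z∈)  y≢z = there (∈-++-∷⁻ xs z∈ y≢z)

Unique-++⁻ˡ : ∀ xs → Unique (xs ++ ys) → Unique xs
Unique-++⁻ˡ []       _            = []
Unique-++⁻ˡ (x ∷ xs) (x∉ ∷ xs++ys!) = All.++⁻ˡ xs x∉ ∷ Unique-++⁻ˡ xs xs++ys!

Unique-++⇒Disjoint : ∀ xs → Unique (xs ++ ys) → Disjoint xs ys
Unique-++⇒Disjoint (x ∷ xs) (x∉ ∷ _)     (here refl , z∈ys) = All.lookup (All.++⁻ʳ xs x∉) z∈ys refl
Unique-++⇒Disjoint (x ∷ xs) (_ ∷ xs++ys!) (there z∈xs , z∈ys) = Unique-++⇒Disjoint xs xs++ys! (z∈xs , z∈ys)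

Disjoint⇒All≢ : Disjoint xs ys → z ∈ ys → All (z ≢_) xs
Disjoint⇒All≢ xs#ys z∈ys = All.tabulate (λ x∈xs z≡x → xs#ys (x∈xs , subst (_∈ _) z≡x z∈ys))

Linked-++-∷⁻ : ∀ {R : A → A → Set} xs → Linked R (xs ++ z ∷ ys) → Linked R (xs ++ [ z ])
Linked-++-∷⁻ []           _          = [-]
Linked-++-∷⁻ (x ∷ [])     (r ∷ _)    = r ∷ [-]
Linked-++-∷⁻ (x ∷ x′ ∷ xs) (r ∷ rs)  = r ∷ Linked-++-∷⁻ (x′ ∷ xs) rs

lookup-injective : Unique xs → ∀ {i j} → lookup xs i ≡ lookup xs j → i ≡ j
lookup-injective {xs = _ ∷ _} _ {fzero} {fzero} _ = refl
lookup-injective (x∉ ∷ _)  {fzero}  {fsuc j} x≡ = ⊥-elim (All.lookup x∉ (∈-lookup j) x≡)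
lookup-injective (x∉ ∷ _)  {fsuc i} {fzero}  ≡x = ⊥-elim (All.lookup x∉ (∈-lookup i) (sym ≡x))
lookup-injective (_ ∷ xs!) {fsuc i} {fsuc j} eq = cong fsuc (lookup-injective xs! eq)

lookup-Linked : ∀ {R : A → A → Set} → Linked R xs → ∀ i j → toℕ j ≡ suc (toℕ i) → R (lookup xs i) (lookup xs j)
lookup-Linked (r ∷ _)  fzero    (fsuc fzero) _  = r
lookup-Linked (_ ∷ rs) (fsuc i) (fsuc j)  eq = lookup-Linked rs i j (suc-injective eq)
lookup-Linked [-]      fzero   (fsuc ())   _
lookup-Linked (_ ∷ _)  fzero   (fsuc (fsuc j)) ()

last : A → List A → A
last x []       = x
last x (y ∷ ys) = last y ys

penultimate : A → A → List A → A
penultimate x y []       = x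
penultimate x y (z ∷ zs) = penultimate y z zs

last-∈ : ∀ (x : A) xs → last x xs ∈ x ∷ xs
last-∈ x []       = here refl
last-∈ x (y ∷ ys) = there (last-∈ y ys)

last-++ : ∀ (x : A) xs ys → last x (xs ++ ys) ≡ last (last x xs) ys
last-++ x []       ys = refl
last-++ x (y ∷ xs) ys = last-++ y xs ys

sum-map-1 : ∀ (xs : List A) → sum (map (λ _ → 1) xs) ≡ length xs
sum-map-1 []       = refl
sum-map-1 (x ∷ xs) = cong suc (sum-map-1 xs)

module _ (w : A → ℕ) where

  sum-map-mono : ∀ {v : A → ℕ} xs → (∀ x → w x ≤ v x) → sum (map w xs) ≤ sum (map v xs)
  sum-map-mono []       _   = z≤n
  sum-map-mono (x ∷ xs) w≤v = +-mono-≤ (w≤v x) (sum-map-mono xs w≤v)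

  sum-map-*ʳ : ∀ c xs → sum (map w xs) * c ≡ sum (map (λ x → w x * c) xs)
  sum-map-*ʳ c []       = refl
  sum-map-*ʳ c (x ∷ xs) = trans (*-distribʳ-+ c (w x) _) (cong (w x * c +_) (sum-map-*ʳ c xs))

  sum-map-++-∷ : ∀ xs → sum (map w (xs ++ y ∷ ys)) ≡ w y + sum (map w (xs ++ ys))
  sum-map-++-∷ []       = refl
  sum-map-++-∷ {y} {ys} (x ∷ xs) = begin
    w x + sum (map w (xs ++ y ∷ ys))     ≡⟨ cong (w x +_) (sum-map-++-∷ xs) ⟩
    w x + (w y + sum (map w (xs ++ ys))) ≡⟨ sym (+-assoc (w x) (w y) _) ⟩
    w x + w y + sum (map w (xs ++ ys))   ≡⟨ cong (_+ sum (map w (xs ++ ys))) (+-comm (w x) (w y)) ⟩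
    w y + w x + sum (map w (xs ++ ys))   ≡⟨ +-assoc (w y) (w x) _ ⟩
    w y + (w x + sum (map w (xs ++ ys))) ∎
    where open ≡-Reasoning

  sum-map-≤-of-support : ∀ ys → Unique ys → (∀ {z} → z ∈ ys → w z ≡ 0 ⊎ z ∈ xs) →
                         sum (map w ys) ≤ sum (map w xs)
  sum-map-≤-of-support []       _            _       = z≤n
  sum-map-≤-of-support (y ∷ ys) (y∉ys ∷ ys!) support with support (here refl)
  ... | inj₁ wy≡0 rewrite wy≡0 = sum-map-≤-of-support ys ys! (support ∘′ there)
  ... | inj₂ y∈xs with ∈-∃++ y∈xs
  ...   | as , bs , refl = begin
    w y + sum (map w ys)         ≤⟨ +-monoʳ-≤ (w y) (sum-map-≤-of-support ys ys! support′) ⟩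
    w y + sum (map w (as ++ bs)) ≡⟨ sym (sum-map-++-∷ as) ⟩
    sum (map w (as ++ y ∷ bs))   ∎
    where
    open ≤-Reasoning
    support′ : ∀ {z} → z ∈ ys → w z ≡ 0 ⊎ z ∈ as ++ bs
    support′ z∈ys with support (there z∈ys)
    ... | inj₁ wz≡0 = inj₁ wz≡0
    ... | inj₂ z∈xs = inj₂ (∈-++-∷⁻ as z∈xs (All.lookup y∉ys z∈ys))

length-≤-of-⊆ : Unique ys → (∀ {z} → z ∈ ys → z ∈ xs) → length ys ≤ length xs
length-≤-of-⊆ {ys = ys} {xs = xs} ys! ys⊆xs = begin
  length ys              ≡⟨ sum-map-1 ys ⟨
  sum (map (λ _ → 1) ys) ≤⟨ sum-map-≤-of-support (λ _ → 1) ys ys! (inj₂ ∘′ ys⊆xs) ⟩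
  sum (map (λ _ → 1) xs) ≡⟨ sum-map-1 xs ⟩
  length xs              ∎
  where open ≤-Reasoning

sum-map-concatMap : ∀ {B : Set} (w : B → ℕ) (f : A → List B) xs →
                    sum (map w (concatMap f xs)) ≡ sum (map (λ x → sum (map w (f x))) xs)
sum-map-concatMap w f []       = refl
sum-map-concatMap w f (x ∷ xs) = begin
  sum (map w (f x ++ concatMap f xs))                        ≡⟨ cong sum (map-++ w (f x) (concatMap f xs)) ⟩
  sum (map w (f x) ++ map w (concatMap f xs))                ≡⟨ sum-++ (map w (f x)) _ ⟩
  sum (map w (f x)) + sum (map w (concatMap f xs))           ≡⟨ cong (sum (map w (f x)) +_) (sum-map-concatMap w f xs) ⟩
  sum (map w (f x)) + sum (map (λ x → sum (map w (f x))) xs) ∎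
  where open ≡-Reasoning

module _ (h : A → ℕ) where

  variation : List A → ℕ
  variation (x ∷ y ∷ xs) = ∣ h x - h y ∣ + variation (y ∷ xs)
  variation _            = 0

  ∣first-last∣≤variation : ∀ x xs → ∣ h x - h (last x xs) ∣ ≤ variation (x ∷ xs)
  ∣first-last∣≤variation x []       = ≤-reflexive (∣n-n∣≡0 (h x))
  ∣first-last∣≤variation x (y ∷ xs) = ≤-trans (∣-∣-triangle (h x) (h y) (h (last y xs)))
    (+-monoʳ-≤ ∣ h x - h y ∣ (∣first-last∣≤variation y xs))

  variation-antitone : ∀ x xs → Linked (λ a b → h b ≤ h a) (x ∷ xs) →
                       h (last x xs) + variation (x ∷ xs) ≡ h x
  variation-antitone x []       _              = +-identityʳ (h x)
  variation-antitone x (y ∷ xs) (hy≤hx ∷ antitone) = begin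
    h ℓ + (∣ h x - h y ∣ + variation (y ∷ xs)) ≡⟨ cong (h ℓ +_) (+-comm ∣ h x - h y ∣ _) ⟩
    h ℓ + (variation (y ∷ xs) + ∣ h x - h y ∣) ≡⟨ sym (+-assoc (h ℓ) _ _) ⟩
    h ℓ + variation (y ∷ xs) + ∣ h x - h y ∣   ≡⟨ cong (_+ ∣ h x - h y ∣) (variation-antitone y xs antitone) ⟩
    h y + ∣ h x - h y ∣                        ≡⟨ cong (h y +_) (m≤n⇒∣n-m∣≡n∸m hy≤hx) ⟩
    h y + (h x ∸ h y)                          ≡⟨ m+[n∸m]≡n hy≤hx ⟩
    h x                                        ∎
    where
    open ≡-Reasoning
    ℓ = last y xs

module GraphTheory {n : ℕ} (G : Graph n) where

  open import Data.List.Membership.DecPropositional (_≟ᶠ_ {n}) using (_∈?_)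

  V : Set
  V = Fin n

  Adj-sym : Adj G x y → Adj G y x
  Adj-sym {x = x} {y = y} = trans (adj-sym G y x)

  Adj⇒≢ : Adj G x y → x ≢ y
  Adj⇒≢ {x = x} x~x refl with trans (sym x~x) (irrefl G x)
  ... | ()

  Adj? : ∀ x y → Dec (Adj G x y)
  Adj? x y = adj G x y Bool.≟ true

  -- Degrees

  adjCount : V → V → ℕ
  adjCount x y = if adj G x y then 1 else 0

  adjCount-Adj : Adj G x y → adjCount x y ≡ 1
  adjCount-Adj x~y = cong (λ b → if b then 1 else 0) x~y

  adjCount-¬Adj : ¬ Adj G x y → adjCount x y ≡ 0
  adjCount-¬Adj {x = x} {y = y} ¬x~y with adj G x y
  ... | true  = ⊥-elim (¬x~y refl)
  ... | false = refl

  length-allFin : length (allFin n) ≡ n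
  length-allFin = length-tabulate (λ i → i)

  unique-length≤n : ∀ {xs : List V} → Unique xs → length xs ≤ n
  unique-length≤n {xs} xs! = subst (length xs ≤_) length-allFin (length-≤-of-⊆ xs! (λ {z} _ → ∈-allFin z))

  covering-length : ∀ {xs : List V} → (∀ z → z ∈ xs) → n ≤ length xs
  covering-length {xs} covers = subst (_≤ length xs) length-allFin (length-≤-of-⊆ (allFin⁺ n) (λ {z} _ → covers z))

  length≤deg : ∀ {x} ys → Unique ys → All (Adj G x) ys → length ys ≤ deg G x
  length≤deg {x} ys ys! x~ys = subst (_≤ deg G x) (count x~ys)
    (sum-map-≤-of-support (adjCount x) ys ys! (λ {z} _ → inj₂ (∈-allFin z)))
    where
    count : ∀ {ys} → All (Adj G x) ys → sum (map (adjCount x) ys) ≡ length ys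
    count []                     = refl
    count {y ∷ _} (x~y ∷ x~ys) rewrite x~y = cong suc (count x~ys)

  deg≥1 : Adj G x y → 1 ≤ deg G x
  deg≥1 x~y = length≤deg _ ([] ∷ []) (x~y ∷ [])

  deg≥2 : Adj G x y → Adj G x z → y ≢ z → 2 ≤ deg G x
  deg≥2 x~y x~z y≢z = length≤deg _ ((y≢z ∷ []) ∷ [] ∷ []) (x~y ∷ x~z ∷ [])

  deg≥3 : ∀ {x a b c} → Adj G x a → Adj G x b → Adj G x c → a ≢ b → a ≢ c → b ≢ c → 3 ≤ deg G x
  deg≥3 x~a x~b x~c a≢b a≢c b≢c =
    length≤deg _ ((a≢b ∷ a≢c ∷ []) ∷ (b≢c ∷ []) ∷ [] ∷ []) (x~a ∷ x~b ∷ x~c ∷ [])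

  neighbour-∉ : ∀ {x} ps → length ps < deg G x → ∃[ y ] Adj G x y × y ∉ ps
  neighbour-∉ {x} ps ps<deg with any? (λ y → Adj? x y ×-dec ¬? (y ∈? ps)) (allFin n)
  ... | yes found = satisfied found
  ... | no none   = ⊥-elim (<⇒≱ ps<deg deg≤ps)
    where
    support : ∀ {z} → z ∈ allFin n → adjCount x z ≡ 0 ⊎ z ∈ ps
    support {z} z∈ with adj G x z in x~z | z ∈? ps
    ... | false | _        = inj₁ refl
    ... | true  | yes z∈ps = inj₂ z∈ps
    ... | true  | no z∉ps  = ⊥-elim (none (lose z∈ (x~z , z∉ps)))
    adjCount≤1 : ∀ z → adjCount x z ≤ 1
    adjCount≤1 z with adj G x z
    ... | false = z≤n
    ... | true  = ≤-refl
    deg≤ps : deg G x ≤ length ps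
    deg≤ps = begin
      deg G x                   ≤⟨ sum-map-≤-of-support (adjCount x) (allFin n) (allFin⁺ n) support ⟩
      sum (map (adjCount x) ps) ≤⟨ sum-map-mono (adjCount x) ps adjCount≤1 ⟩
      sum (map (λ _ → 1) ps)    ≡⟨ sum-map-1 ps ⟩
      length ps                 ∎
      where open ≤-Reasoning

  neighbour : 1 ≤ deg G x → ∃[ y ] Adj G x y
  neighbour 1≤deg with neighbour-∉ [] 1≤deg
  ... | y , x~y , _ = y , x~y

  neighbour-≢ : 2 ≤ deg G x → ∀ p → ∃[ y ] Adj G x y × y ≢ p
  neighbour-≢ 2≤deg p with neighbour-∉ [ p ] 2≤deg
  ... | y , x~y , y∉ = y , x~y , λ y≡p → y∉ (here y≡p)

  neighbour-≢₂ : 3 ≤ deg G x → ∀ p q → ∃[ y ] Adj G x y × y ≢ p × y ≢ q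
  neighbour-≢₂ 3≤deg p q with neighbour-∉ (p ∷ q ∷ []) 3≤deg
  ... | y , x~y , y∉ = y , x~y , (λ y≡p → y∉ (here y≡p)) , (λ y≡q → y∉ (there (here y≡q)))

  deg≤Δ : ∀ x → deg G x ≤ Δ G
  deg≤Δ x = foldr-preservesᵒ (λ a b → Sum.[ (λ d≤a → ≤-trans d≤a (m≤m⊔n a b)) , (λ d≤b → ≤-trans d≤b (m≤n⊔m a b)) ])
              0 (map (deg G) (allFin n)) (inj₂ (Any.map ≤-reflexive (∈-map⁺ (deg G) (∈-allFin x))))

  Δ-attained : V → ∃[ v ] deg G v ≡ Δ G
  Δ-attained x with foldr-selective ⊔-sel 0 (map (deg G) (allFin n))
  ... | inj₁ Δ≡0 = x , ≤-antisym (deg≤Δ x) (subst (_≤ deg G x) (sym Δ≡0) z≤n)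
  ... | inj₂ Δ∈  with ∈-map⁻ (deg G) Δ∈
  ...   | v , _ , Δ≡deg = v , sym Δ≡deg

  deg² : V → ℕ
  deg² x = deg G x * deg G x

  -- The index of the star with deg v leaves.
  starBound : V → ℕ
  starBound v = deg G v * (deg² v ∸ 1)

  StarlikeAt : V → Set
  StarlikeAt v = ∀ x → x ≢ v → deg G x ≤ 2

  starlike? : ∀ v → StarlikeAt v ⊎ ∃[ w ] w ≢ v × 2 < deg G w
  starlike? v with any? (λ w → ¬? (w ≟ᶠ v) ×-dec (2 <? deg G w)) (allFin n)
  ... | yes found = inj₂ (satisfied found)
  ... | no none   = inj₁ λ x x≢v → ≮⇒≥ λ 2<x → none (lose (∈-allFin x) (x≢v , 2<x))

  starlike-deg≤2 : ∀ {v} → StarlikeAt v → deg G v ≤ 2 → ∀ x → deg G x ≤ 2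
  starlike-deg≤2 {v} starlike v≤2 x with x ≟ᶠ v
  ... | yes refl = v≤2
  ... | no x≢v   = starlike x x≢v

  starlike-unique-big : ∀ {v w} → StarlikeAt v → 2 < deg G w → w ≡ v
  starlike-unique-big {v} {w} starlike 2<w with w ≟ᶠ v
  ... | yes w≡v = w≡v
  ... | no w≢v  = ⊥-elim (<⇒≱ 2<w (starlike w w≢v))

  -- FWI* as a sum over edges

  -- The ordered pair under which FWI* counts the edge ab.
  edge : V → V → V × V
  edge a b = if toℕ a <ᵇ toℕ b then (a , b) else (b , a)

  weight : V × V → ℕ
  weight (a , b) = pairTerm G a b

  edge-cases : ∀ a b → edge a b ≡ (a , b) ⊎ edge a b ≡ (b , a)
  edge-cases a b with toℕ a <ᵇ toℕ b
  ... | true  = inj₁ refl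
  ... | false = inj₂ refl

  edge-≡⁻ : ∀ {a b c d} → edge a b ≡ edge c d → (a ≡ c × b ≡ d) ⊎ (a ≡ d × b ≡ c)
  edge-≡⁻ {a} {b} {c} {d} ab≡cd with edge-cases a b | edge-cases c d
  ... | inj₁ ab | inj₁ cd = inj₁ (,-injective (trans (sym ab) (trans ab≡cd cd)))
  ... | inj₁ ab | inj₂ dc = inj₂ (,-injective (trans (sym ab) (trans ab≡cd dc)))
  ... | inj₂ ba | inj₁ cd = inj₂ (swap (,-injective (trans (sym ba) (trans ab≡cd cd))))
  ... | inj₂ ba | inj₂ dc = inj₁ (swap (,-injective (trans (sym ba) (trans ab≡cd dc))))

  toℕ-≢ : ∀ {a b : V} → a ≢ b → toℕ a ≢ toℕ b
  toℕ-≢ a≢b = a≢b ∘′ toℕ-injective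

  edge-comm : ∀ {a b} → a ≢ b → edge a b ≡ edge b a
  edge-comm {a} {b} a≢b with toℕ a <ᵇ toℕ b in a<b
  ... | true  rewrite <ᵇ-asym (toℕ a) (toℕ b) a<b = refl
  ... | false rewrite <ᵇ-flip (toℕ a) (toℕ b) a<b (toℕ-≢ a≢b) = refl

  weight-edge : ∀ {a b} → Adj G a b → weight (edge a b) ≡ ∣ deg² a - deg² b ∣
  weight-edge {a} {b} a~b with toℕ a <ᵇ toℕ b in a<b
  ... | true  rewrite a~b | a<b = refl
  ... | false rewrite Adj-sym a~b | <ᵇ-flip (toℕ a) (toℕ b) a<b (toℕ-≢ (Adj⇒≢ a~b)) = ∣-∣-comm (deg² b) (deg² a)

  allPairs : List (V × V)
  allPairs = cartesianProduct (allFin n) (allFin n)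

  FWI*≡sum-allPairs : FWI* G ≡ sum (map weight allPairs)
  FWI*≡sum-allPairs = cong sum (rows (allFin n))
    where
    rows : ∀ us → concatMap (λ u → map (pairTerm G u) (allFin n)) us ≡ map weight (cartesianProduct us (allFin n))
    rows []       = refl
    rows (u ∷ us) = trans (cong₂ _++_ (map-∘ (allFin n)) (rows us))
                          (sym (map-++ weight (map (u ,_) (allFin n)) (cartesianProduct us (allFin n))))

  sum≤FWI* : ∀ {X} → Unique X → sum (map weight X) ≤ FWI* G
  sum≤FWI* {X} X! = begin
    sum (map weight X)        ≤⟨ sum-map-≤-of-support weight X X! (λ {(a , b)} _ →
                                   inj₂ (∈-cartesianProduct⁺ (∈-allFin a) (∈-allFin b))) ⟩
    sum (map weight allPairs) ≡⟨ FWI*≡sum-allPairs ⟨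
    FWI* G                    ∎
    where open ≤-Reasoning

  FWI*≤sum : ∀ {X} → (∀ {a b} → Adj G a b → edge a b ∈ X) → FWI* G ≤ sum (map weight X)
  FWI*≤sum {X} covers = begin
    FWI* G                    ≡⟨ FWI*≡sum-allPairs ⟩
    sum (map weight allPairs) ≤⟨ sum-map-≤-of-support weight allPairs
                                   (Unique.cartesianProduct⁺ (allFin⁺ n) (allFin⁺ n)) support ⟩
    sum (map weight X)        ∎
    where
    open ≤-Reasoning
    support : ∀ {e} → e ∈ allPairs → weight e ≡ 0 ⊎ e ∈ X
    support {a , b} _ with adj G a b in a~b | toℕ a <ᵇ toℕ b in a<b
    ... | false | _     = inj₁ refl
    ... | true  | false = inj₁ refl
    ... | true  | true  = inj₂ (subst (_∈ X) (edge≡ a<b) (covers a~b))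
      where
      edge≡ : (toℕ a <ᵇ toℕ b) ≡ true → edge a b ≡ (a , b)
      edge≡ a<b rewrite a<b = refl

  edges : List V → List (V × V)
  edges (x ∷ y ∷ xs) = edge x y ∷ edges (y ∷ xs)
  edges _            = []

  edges-++⁺ˡ : ∀ {e} x xs → e ∈ edges (x ∷ xs) → e ∈ edges (x ∷ xs ++ ys)
  edges-++⁺ˡ x (y ∷ xs) (here e≡)  = here e≡
  edges-++⁺ˡ x (y ∷ xs) (there e∈) = there (edges-++⁺ˡ y xs e∈)

  edges-++⁺ʳ : ∀ {e} x xs → e ∈ edges (last x xs ∷ ys) → e ∈ edges (x ∷ xs ++ ys)
  edges-++⁺ʳ x []       e∈ = e∈
  edges-++⁺ʳ x (y ∷ xs) e∈ = there (edges-++⁺ʳ y xs e∈)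

  edges-last : ∀ x y ys → edge (penultimate x y ys) (last y ys) ∈ edges (x ∷ y ∷ ys)
  edges-last x y []       = here refl
  edges-last x y (z ∷ zs) = there (edges-last y z zs)

  -- Non-backtracking walks

  data NBWalk : List V → Set where
    [-]    : NBWalk [ x ]
    ⟪_⟫    : Adj G x y → NBWalk (x ∷ y ∷ [])
    _∷⟪_⟫_ : Adj G x y → x ≢ z → NBWalk (y ∷ z ∷ zs) → NBWalk (x ∷ y ∷ z ∷ zs)

  NBWalk-head : NBWalk (x ∷ y ∷ xs) → Adj G x y
  NBWalk-head ⟪ x~y ⟫        = x~y
  NBWalk-head (x~y ∷⟪ _ ⟫ _) = x~y

  NBWalk-tail : NBWalk (x ∷ y ∷ ys) → NBWalk (y ∷ ys)
  NBWalk-tail ⟪ _ ⟫        = [-]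
  NBWalk-tail (_ ∷⟪ _ ⟫ w) = w

  NBWalk⇒Linked : NBWalk xs → Linked (Adj G) xs
  NBWalk⇒Linked [-]            = [-]
  NBWalk⇒Linked ⟪ x~y ⟫        = x~y ∷ [-]
  NBWalk⇒Linked (x~y ∷⟪ _ ⟫ w) = x~y ∷ NBWalk⇒Linked w

  NBWalk-last-edge : NBWalk (x ∷ y ∷ ys) → Adj G (penultimate x y ys) (last y ys)
  NBWalk-last-edge ⟪ x~y ⟫      = x~y
  NBWalk-last-edge (_ ∷⟪ _ ⟫ w) = NBWalk-last-edge w

  NBWalk-++ : NBWalk (x ∷ y ∷ ys) → NBWalk (penultimate x y ys ∷ last y ys ∷ zs) → NBWalk (x ∷ y ∷ ys ++ zs)
  NBWalk-++ ⟪ _ ⟫              w′ = w′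
  NBWalk-++ (x~y ∷⟪ x≢z ⟫ w) w′ = x~y ∷⟪ x≢z ⟫ NBWalk-++ w w′

  walk⇒NBWalk : ∀ {a b} → Walk G a b → ∃[ xs ] NBWalk (a ∷ xs) × last a xs ≡ b
  walk⇒NBWalk here = [] , [-] , refl
  walk⇒NBWalk (step {u} {w} u~w rest) with walk⇒NBWalk rest
  ... | []     , _ , w≡b = w ∷ [] , ⟪ u~w ⟫ , w≡b
  ... | x ∷ xs , w′ , ends with x ≟ᶠ u
  ...   | yes refl = xs , NBWalk-tail w′ , ends
  ...   | no x≢u   = w ∷ x ∷ xs , u~w ∷⟪ x≢u ∘′ sym ⟫ w′ , ends

  sum-weight-edges : NBWalk xs → sum (map weight (edges xs)) ≡ variation deg² xs
  sum-weight-edges [-]            = refl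
  sum-weight-edges ⟪ x~y ⟫        = cong (_+ 0) (weight-edge x~y)
  sum-weight-edges (x~y ∷⟪ _ ⟫ w) = cong₂ _+_ (weight-edge x~y) (sum-weight-edges w)

  ∈-edges⁻ : ∀ {e} → NBWalk xs → e ∈ edges xs → ∃₂ λ a b → Adj G a b × a ∈ xs × b ∈ xs × e ≡ edge a b
  ∈-edges⁻ ⟪ x~y ⟫        (here e≡)  = _ , _ , x~y , here refl , there (here refl) , e≡
  ∈-edges⁻ ⟪ _ ⟫          (there ())
  ∈-edges⁻ (x~y ∷⟪ _ ⟫ _) (here e≡)  = _ , _ , x~y , here refl , there (here refl) , e≡
  ∈-edges⁻ (_ ∷⟪ _ ⟫ w)   (there e∈) with ∈-edges⁻ w e∈
  ... | a , b , a~b , a∈ , b∈ , e≡ = a , b , a~b , there a∈ , there b∈ , e≡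

  edge-∉-edges : ∀ {e} → NBWalk xs → x ∉ xs → e ∈ edges xs → edge x y ≢ e
  edge-∉-edges w x∉ e∈ xy≡e with ∈-edges⁻ w e∈
  ... | a , b , _ , a∈ , b∈ , e≡ab with edge-≡⁻ (trans xy≡e e≡ab)
  ...   | inj₁ (refl , _) = x∉ a∈
  ...   | inj₂ (refl , _) = x∉ b∈

  edges-unique : NBWalk xs → Unique xs → Unique (edges xs)
  edges-unique [-]          _          = []
  edges-unique ⟪ _ ⟫        _          = [] ∷ []
  edges-unique (_ ∷⟪ _ ⟫ w) (x∉ ∷ xs!) =
    All.tabulate (edge-∉-edges w (All.All¬⇒¬Any x∉)) ∷ edges-unique w xs!

  edges-disjoint : ∀ {P Q c} → NBWalk P → NBWalk Q → (∀ {z} → z ∈ P → z ∈ Q → z ≡ c) →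
                   Disjoint (edges P) (edges Q)
  edges-disjoint wP wQ meet (e∈P , e∈Q) with ∈-edges⁻ wP e∈P | ∈-edges⁻ wQ e∈Q
  ... | a , b , a~b , a∈P , b∈P , e≡ab | c , d , _ , c∈Q , d∈Q , e≡cd with edge-≡⁻ (trans (sym e≡ab) e≡cd)
  ...   | inj₁ (refl , refl) = Adj⇒≢ a~b (trans (meet a∈P c∈Q) (sym (meet b∈P d∈Q)))
  ...   | inj₂ (refl , refl) = Adj⇒≢ a~b (trans (meet a∈P d∈Q) (sym (meet b∈P c∈Q)))

  record LeafWalk (x y : V) : Set where
    constructor leafWalk
    field
      rest         : List V
      walk         : NBWalk (x ∷ y ∷ rest)
      ends-at-leaf : deg G (last y rest) ≡ 1

  open LeafWalk public

  prefix-of-leafWalk : (ℓ : LeafWalk x y) → All (λ z → deg G z ≤ 2) (y ∷ rest ℓ) →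
                       NBWalk (x ∷ y ∷ ys) → ∃[ zs ] rest ℓ ≡ ys ++ zs
  prefix-of-leafWalk ℓ _ ⟪ _ ⟫ = rest ℓ , refl
  prefix-of-leafWalk (leafWalk [] _ leaf) _ (x~y ∷⟪ x≢c ⟫ w) =
    ⊥-elim (1+n≰n (subst (2 ≤_) leaf (deg≥2 (Adj-sym x~y) (NBWalk-head w) x≢c)))
  prefix-of-leafWalk {ys = c ∷ _} (leafWalk (d ∷ ds) (_ ∷⟪ x≢d ⟫ w′) leaf) (y≤2 ∷ small) (x~y ∷⟪ x≢c ⟫ w)
    with c ≟ᶠ d
  ... | yes refl = Product.map₂ (cong (c ∷_)) (prefix-of-leafWalk (leafWalk ds w′ leaf) small w)
  ... | no c≢d   = ⊥-elim (<⇒≱ (deg≥3 (Adj-sym x~y) (NBWalk-head w) (NBWalk-head w′) x≢c x≢d c≢d) y≤2)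

  -- Interior vertices of a non-backtracking walk have degree at least 2.
  deg-antitone : ∀ {p} → NBWalk (p ∷ x ∷ xs) → All (λ z → deg G z ≤ 2) (x ∷ xs) →
                 Linked (λ a b → deg G b ≤ deg G a) (x ∷ xs)
  deg-antitone ⟪ _ ⟫              _                 = [-]
  deg-antitone (p~x ∷⟪ p≢y ⟫ w) (_ ∷ y≤2 ∷ small) =
    ≤-trans y≤2 (deg≥2 (Adj-sym p~x) (NBWalk-head w) p≢y) ∷ deg-antitone w (y≤2 ∷ small)

  edge-on-NBWalk-from : Connected G → ∀ v {a b} → Adj G a b →
                        ∃₂ λ u ys → NBWalk (v ∷ u ∷ ys) × edge a b ∈ edges (v ∷ u ∷ ys)
  edge-on-NBWalk-from connected v {a} {b} a~b with walk⇒NBWalk (connected v a)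
  ... | []     , _ , refl = b , [] , ⟪ a~b ⟫ , here refl
  ... | u ∷ ys , w , refl with penultimate v u ys ≟ᶠ b
  ...   | yes refl = u , ys , w ,
    subst (_∈ edges (v ∷ u ∷ ys)) (edge-comm (Adj⇒≢ (NBWalk-last-edge w))) (edges-last v u ys)
  ...   | no p≢b   = u , ys ++ [ b ] , NBWalk-++ w (NBWalk-last-edge w ∷⟪ p≢b ⟫ ⟪ a~b ⟫) ,
    there (edges-++⁺ʳ u ys (here refl))

  leafWalk-variation-≥ : (ℓ : LeafWalk x y) → deg² x ∸ 1 ≤ variation deg² (x ∷ y ∷ rest ℓ)
  leafWalk-variation-≥ {x} {y} (leafWalk ws _ leaf) = begin
    deg² x ∸ 1                    ≤⟨ m∸n≤∣m-n∣ (deg² x) 1 ⟩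
    ∣ deg² x - 1 ∣                ≡⟨ cong (λ d → ∣ deg² x - d * d ∣) leaf ⟨
    ∣ deg² x - deg² (last y ws) ∣ ≤⟨ ∣first-last∣≤variation deg² x (y ∷ ws) ⟩
    variation deg² (x ∷ y ∷ ws)   ∎
    where open ≤-Reasoning

  leafWalk-variation-≡ : (ℓ : LeafWalk x y) → deg G y ≤ deg G x → All (λ z → deg G z ≤ 2) (y ∷ rest ℓ) →
                         variation deg² (x ∷ y ∷ rest ℓ) ≡ deg² x ∸ 1
  leafWalk-variation-≡ {x} {y} (leafWalk ws w leaf) y≤x small = begin
    variation deg² (x ∷ y ∷ ws)                        ≡⟨ m+n∸m≡n 1 _ ⟨
    1 + variation deg² (x ∷ y ∷ ws) ∸ 1                ≡⟨ cong (λ d → d * d + variation deg² (x ∷ y ∷ ws) ∸ 1) leaf ⟨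
    deg² (last y ws) + variation deg² (x ∷ y ∷ ws) ∸ 1 ≡⟨ cong (_∸ 1) (variation-antitone deg² x (y ∷ ws) antitone) ⟩
    deg² x ∸ 1                                         ∎
    where
    open ≡-Reasoning
    antitone : Linked (λ a b → deg² b ≤ deg² a) (x ∷ y ∷ ws)
    antitone = Linked.map (λ d≤ → *-mono-≤ d≤ d≤) (y≤x ∷ deg-antitone w small)

  -- Paths

  IsPath⇒deg≤2 : IsPath G → ∀ x → deg G x ≤ 2
  IsPath⇒deg≤2 (σ , (_ , σ-surjective) , adj⇔) x = ≮⇒≥ no-three-neighbours
    where
    σ⁻¹ : V → V
    σ⁻¹ y = proj₁ (σ-surjective y)
    σ∘σ⁻¹ : ∀ y → σ (σ⁻¹ y) ≡ y
    σ∘σ⁻¹ y = proj₂ (σ-surjective y) refl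
    distance : Adj G x y → ∣ toℕ (σ⁻¹ x) - toℕ (σ⁻¹ y) ∣ ≡ 1
    distance {y = y} x~y = Equivalence.to (adj⇔ (σ⁻¹ x) (σ⁻¹ y))
      (subst₂ (Adj G) (sym (σ∘σ⁻¹ x)) (sym (σ∘σ⁻¹ y)) x~y)
    σ⁻¹-injective : toℕ (σ⁻¹ y) ≡ toℕ (σ⁻¹ z) → y ≡ z
    σ⁻¹-injective {y = y} {z = z} eq =
      trans (sym (σ∘σ⁻¹ y)) (trans (cong σ (toℕ-injective eq)) (σ∘σ⁻¹ z))
    no-three-neighbours : ¬ (2 < deg G x)
    no-three-neighbours 3≤deg =
      let a , x~a           = neighbour (≤-trans (s≤s z≤n) 3≤deg)
          b , x~b , b≢a     = neighbour-≢ (≤-trans (s≤s (s≤s z≤n)) 3≤deg) a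
          c , x~c , c≢a , c≢b = neighbour-≢₂ 3≤deg a b
      in case distance-1-pigeonhole {toℕ (σ⁻¹ x)} (distance x~a) (distance x~b) (distance x~c) of λ where
        (inj₁ a≡b)        → b≢a (sym (σ⁻¹-injective a≡b))
        (inj₂ (inj₁ a≡c)) → c≢a (sym (σ⁻¹-injective a≡c))
        (inj₂ (inj₂ b≡c)) → c≢b (sym (σ⁻¹-injective b≡c))

  shape⇒starlike : ∀ {v} → (∀ x → deg G x ≤ deg G v) → IsPath G ⊎ ExactlyOneBig G → StarlikeAt v
  shape⇒starlike _ (inj₁ path) x _ = IsPath⇒deg≤2 path x
  shape⇒starlike {v} maximal (inj₂ (c , 2<c , unique)) x x≢v =
    ≮⇒≥ λ 2<x → x≢v (trans (unique x 2<x) (sym (unique v (<-≤-trans 2<c (maximal c)))))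

  module Acyclic (acyclic : ¬ HasCycle G) where

    no-chord : NBWalk (x ∷ y ∷ ys) → Unique (x ∷ y ∷ ys) → Adj G x z → z ∉ ys
    no-chord {x} {y} {z = z} w xs! x~z z∈ys with ∈-∃++ z∈ys
    ... | pre , post , refl =
      acyclic (z , x ∷ y ∷ pre , s≤s (s≤s z≤n) , cycle! ,
               Adj-sym x~z ∷ Linked-++-∷⁻ (x ∷ y ∷ pre) (NBWalk⇒Linked w))
      where
      cycle! : Unique (z ∷ x ∷ y ∷ pre)
      cycle! = Disjoint⇒All≢ (Unique-++⇒Disjoint (x ∷ y ∷ pre) xs!) (here refl) ∷ Unique-++⁻ˡ (x ∷ y ∷ pre) xs!

    neighbour-off-path : NBWalk (x ∷ y ∷ ys) → Unique (x ∷ y ∷ ys) → Adj G x z → z ≢ y → z ∉ x ∷ y ∷ ys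
    neighbour-off-path _    _     x~z _   (here z≡x)         = Adj⇒≢ x~z (sym z≡x)
    neighbour-off-path _    _     _   z≢y (there (here z≡y)) = z≢y z≡y
    neighbour-off-path path path! x~z _   (there (there z∈)) = no-chord path path! x~z z∈

    -- A non-backtracking walk that leaves the end x of a path other than towards y never meets the path again.
    escape : NBWalk (x ∷ y ∷ ys) → Unique (x ∷ y ∷ ys) → NBWalk (y ∷ x ∷ zs) →
             Unique zs × Disjoint zs (x ∷ y ∷ ys)
    escape _ _ ⟪ _ ⟫ = [] , λ { (() , _) }
    escape path path! (_ ∷⟪ y≢w ⟫ walk) =
      let w∉path           = neighbour-off-path path path! (NBWalk-head walk) (y≢w ∘′ sym)
          zs! , zs#path′ = escape (Adj-sym (NBWalk-head walk) ∷⟪ y≢w ∘′ sym ⟫ path)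
                                  (All.¬Any⇒All¬ _ w∉path ∷ path!) walk
      in Disjoint⇒All≢ zs#path′ (here refl) ∷ zs! , λ where
           (here refl  , w∈path) → w∉path w∈path
           (there z∈zs , z∈path) → zs#path′ (z∈zs , there z∈path)

    NBWalk⇒Unique : NBWalk (x ∷ y ∷ ys) → Unique (x ∷ y ∷ ys)
    NBWalk⇒Unique w =
      let x~y        = NBWalk-head w
          ys! , ys#yx = escape ⟪ Adj-sym x~y ⟫ ((Adj⇒≢ (Adj-sym x~y) ∷ []) ∷ [] ∷ []) w
      in (Adj⇒≢ x~y ∷ Disjoint⇒All≢ ys#yx (there (here refl))) ∷ Disjoint⇒All≢ ys#yx (here refl) ∷ ys!

    branches-disjoint : ∀ {v u u′ as as′} → NBWalk (v ∷ u ∷ as) → NBWalk (v ∷ u′ ∷ as′) → u ≢ u′ →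
                        Disjoint (u ∷ as) (u′ ∷ as′)
    branches-disjoint w w′ u≢u′ (z∈ , z∈′) =
      proj₂ (escape w (NBWalk⇒Unique w) (Adj-sym (NBWalk-head w) ∷⟪ u≢u′ ⟫ w′)) (z∈′ , there z∈)

    branches-meet-at-root : ∀ {v u u′ as as′} → NBWalk (v ∷ u ∷ as) → NBWalk (v ∷ u′ ∷ as′) → u ≢ u′ →
                            z ∈ v ∷ u ∷ as → z ∈ v ∷ u′ ∷ as′ → z ≡ v
    branches-meet-at-root _ _ _     (here z≡v) _           = z≡v
    branches-meet-at-root _ _ _     (there _)  (here z≡v)  = z≡v
    branches-meet-at-root w w′ u≢u′ (there z∈) (there z∈′) = ⊥-elim (branches-disjoint w w′ u≢u′ (z∈ , z∈′))

    extend : ∀ k → Adj G x y → ∃[ ws ] NBWalk (x ∷ y ∷ ws) × (deg G (last y ws) ≡ 1 ⊎ k ≤ length ws)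
    extend zero    x~y = [] , ⟪ x~y ⟫ , inj₂ z≤n
    extend {x} {y} (suc k) x~y with deg G y ≟ 1
    ... | yes leaf = [] , ⟪ x~y ⟫ , inj₁ leaf
    ... | no ¬leaf with neighbour-≢ (≤∧≢⇒< (deg≥1 (Adj-sym x~y)) (¬leaf ∘′ sym)) x
    ...   | z , y~z , z≢x with extend k y~z
    ...     | ws , w , done = z ∷ ws , x~y ∷⟪ z≢x ∘′ sym ⟫ w , Sum.map₂ s≤s done

    -- Extension terminates because a non-backtracking walk in a forest repeats no vertex.
    leafWalk-from : Adj G x y → LeafWalk x y
    leafWalk-from x~y with extend n x~y
    ... | ws , w , inj₁ leaf = leafWalk ws w leaf
    ... | ws , w , inj₂ n≤ws = ⊥-elim (<⇒≱ (≤-trans (s≤s n≤ws) (n≤1+n _)) (unique-length≤n (NBWalk⇒Unique w)))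

    module Legs (v : V) (leg : ∀ {u} → Adj G v u → LeafWalk v u) where

      legEdges : V → List (V × V)
      legEdges u = edgesIf (Adj? v u)
        where
        edgesIf : Dec (Adj G v u) → List (V × V)
        edgesIf (yes v~u) = edges (v ∷ u ∷ rest (leg v~u))
        edgesIf (no _)    = []

      legWeight : V → ℕ
      legWeight u = sum (map weight (legEdges u))

      allLegEdges : List (V × V)
      allLegEdges = concatMap legEdges (allFin n)

      legEdges-unique : ∀ u → Unique (legEdges u)
      legEdges-unique u with Adj? v u
      ... | yes v~u = edges-unique (walk (leg v~u)) (NBWalk⇒Unique (walk (leg v~u)))
      ... | no _    = []

      legEdges-disjoint : ∀ {u u′} → u ≢ u′ → Disjoint (legEdges u) (legEdges u′)
      legEdges-disjoint {u} {u′} u≢u′ with Adj? v u | Adj? v u′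
      ... | yes v~u | yes v~u′ = edges-disjoint (walk (leg v~u)) (walk (leg v~u′))
                                   (branches-meet-at-root (walk (leg v~u)) (walk (leg v~u′)) u≢u′)
      ... | yes _   | no _     = λ { (_ , ()) }
      ... | no _    | _        = λ { (() , _) }

      allLegEdges-unique : Unique allLegEdges
      allLegEdges-unique = Unique.concat⁺ (All.map⁺ (All.universal legEdges-unique (allFin n)))
                                          (AllPairs.map⁺ (AllPairs.map legEdges-disjoint (allFin⁺ n)))

      sum-allLegEdges : sum (map weight allLegEdges) ≡ sum (map legWeight (allFin n))
      sum-allLegEdges = sum-map-concatMap weight legEdges (allFin n)

      ∈-allLegEdges⁻ : ∀ {e} → e ∈ allLegEdges → ∃[ u ] Σ (Adj G v u) λ v~u → e ∈ edges (v ∷ u ∷ rest (leg v~u))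
      ∈-allLegEdges⁻ {e} e∈ = let u , e∈u = satisfied (∈-concatMap⁻ legEdges {xs = allFin n} e∈)
                              in u , on-leg u e∈u
        where
        on-leg : ∀ u → e ∈ legEdges u → Σ (Adj G v u) λ v~u → e ∈ edges (v ∷ u ∷ rest (leg v~u))
        on-leg u e∈ with Adj? v u
        ... | yes v~u = v~u , e∈

      ∈-allLegEdges⁺ : ∀ {e u} → Adj G v u → (∀ v~u → e ∈ edges (v ∷ u ∷ rest (leg v~u))) → e ∈ allLegEdges
      ∈-allLegEdges⁺ {e} {u} v~u on-leg = ∈-concatMap⁺ legEdges (lose (∈-allFin u) in-legEdges)
        where
        in-legEdges : e ∈ legEdges u
        in-legEdges with Adj? v u
        ... | yes v~u′ = on-leg v~u′
        ... | no ¬v~u  = ⊥-elim (¬v~u v~u)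

      legWeight-≥ : ∀ u → adjCount v u * (deg² v ∸ 1) ≤ legWeight u
      legWeight-≥ u with Adj? v u
      ... | no ¬v~u = ≤-reflexive (cong (_* (deg² v ∸ 1)) (adjCount-¬Adj ¬v~u))
      ... | yes v~u = begin
        adjCount v u * (deg² v ∸ 1)                       ≡⟨ cong (_* (deg² v ∸ 1)) (adjCount-Adj v~u) ⟩
        1 * (deg² v ∸ 1)                                  ≡⟨ *-identityˡ _ ⟩
        deg² v ∸ 1                                        ≤⟨ leafWalk-variation-≥ (leg v~u) ⟩
        variation deg² (v ∷ u ∷ rest (leg v~u))           ≡⟨ sum-weight-edges (walk (leg v~u)) ⟨
        sum (map weight (edges (v ∷ u ∷ rest (leg v~u)))) ∎
        where open ≤-Reasoning

      legs-lower-bound : starBound v ≤ sum (map weight allLegEdges)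
      legs-lower-bound = begin
        starBound v                                              ≡⟨ sum-map-*ʳ (adjCount v) _ (allFin n) ⟩
        sum (map (λ u → adjCount v u * (deg² v ∸ 1)) (allFin n)) ≤⟨ sum-map-mono _ (allFin n) legWeight-≥ ⟩
        sum (map legWeight (allFin n))                           ≡⟨ sum-allLegEdges ⟨
        sum (map weight allLegEdges)                             ∎
        where open ≤-Reasoning

      FWI*-≥-legs+extra : ∀ {X} → Unique X → Disjoint allLegEdges X → starBound v + sum (map weight X) ≤ FWI* G
      FWI*-≥-legs+extra {X} X! disjoint = begin
        starBound v + sum (map weight X)                  ≤⟨ +-monoˡ-≤ _ legs-lower-bound ⟩
        sum (map weight allLegEdges) + sum (map weight X) ≡⟨ sum-++ (map weight allLegEdges) _ ⟨
        sum (map weight allLegEdges ++ map weight X)      ≡⟨ cong sum (map-++ weight allLegEdges X) ⟨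
        sum (map weight (allLegEdges ++ X))               ≤⟨ sum≤FWI* (Unique.++⁺ allLegEdges-unique X! disjoint) ⟩
        FWI* G                                            ∎
        where open ≤-Reasoning

    FWI*-≥ : ∀ v → starBound v ≤ FWI* G
    FWI*-≥ v = ≤-trans legs-lower-bound (sum≤FWI* allLegEdges-unique)
      where open Legs v leafWalk-from

    adjacent-indices : ∀ {P} → NBWalk P → Unique P → ∀ i j → Adj G (lookup P i) (lookup P j) →
                       toℕ j ≡ suc (toℕ i) ⊎ toℕ i ≡ suc (toℕ j)
    adjacent-indices {x ∷ _}         _ _  fzero           fzero           x~x = ⊥-elim (Adj⇒≢ x~x refl)
    adjacent-indices {_ ∷ _ ∷ _}     _ _  fzero           (fsuc fzero)    _   = inj₁ refl
    adjacent-indices {_ ∷ _ ∷ _}     _ _  (fsuc fzero)    fzero           _   = inj₂ refl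
    adjacent-indices {_ ∷ _ ∷ _}     w P! fzero           (fsuc (fsuc j)) x~z =
      ⊥-elim (no-chord w P! x~z (∈-lookup j))
    adjacent-indices {_ ∷ _ ∷ _}     w P! (fsuc (fsuc i)) fzero           z~x =
      ⊥-elim (no-chord w P! (Adj-sym z~x) (∈-lookup i))
    adjacent-indices {_ ∷ _ ∷ _}     w (_ ∷ P!) (fsuc i)  (fsuc j)        e   =
      Sum.map (cong suc) (cong suc) (adjacent-indices (NBWalk-tail w) P! i j e)

    path-listing⇒IsPath : ∀ {P} → NBWalk P → Unique P → (∀ z → z ∈ P) → IsPath G
    path-listing⇒IsPath {P} w P! covers = σ , (σ-injective , σ-surjective) , adj⇔
      where
      n≡length : n ≡ length P
      n≡length = ≤-antisym (covering-length covers) (unique-length≤n P!)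
      σ : V → V
      σ i = lookup P (cast n≡length i)
      σ-injective : ∀ {i j} → σ i ≡ σ j → i ≡ j
      σ-injective {i} {j} eq = toℕ-injective (begin
        toℕ i                 ≡⟨ toℕ-cast n≡length i ⟨
        toℕ (cast n≡length i) ≡⟨ cong toℕ (lookup-injective P! eq) ⟩
        toℕ (cast n≡length j) ≡⟨ toℕ-cast n≡length j ⟩
        toℕ j                 ∎)
        where open ≡-Reasoning
      σ-surjective : ∀ y → ∃ λ i → ∀ {j} → j ≡ i → σ j ≡ y
      σ-surjective y = cast (sym n≡length) (Any.index (covers y)) , λ { refl →
        trans (cong (lookup P) (cast-involutive n≡length (sym n≡length) _))
              (sym (lookup-index (covers y))) }
      consecutive⇔ : ∀ i j → Adj G (σ i) (σ j) ⇔ (toℕ j ≡ suc (toℕ i) ⊎ toℕ i ≡ suc (toℕ j))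
      consecutive⇔ i j
        rewrite sym (toℕ-cast n≡length i) | sym (toℕ-cast n≡length j) =
        mk⇔ (adjacent-indices w P! _ _)
            Sum.[ lookup-Linked (NBWalk⇒Linked w) _ _ , Adj-sym ∘′ lookup-Linked (NBWalk⇒Linked w) _ _ ]
      adj⇔ : ∀ i j → Adj G (σ i) (σ j) ⇔ (∣ toℕ i - toℕ j ∣ ≡ 1)
      adj⇔ i j = ⇔-trans (consecutive⇔ i j) (⇔-sym (∣m-n∣≡1⇔ _ _))

    leafWalk-tail-≤2 : ∀ {v u} → StarlikeAt v → (ℓ : LeafWalk v u) → All (λ z → deg G z ≤ 2) (u ∷ rest ℓ)
    leafWalk-tail-≤2 starlike ℓ with NBWalk⇒Unique (walk ℓ)
    ... | v∉tail ∷ _ = All.map (λ {z} v≢z → starlike z (v≢z ∘′ sym)) v∉tail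

    leafWalk-through : ∀ {v u us s} → NBWalk (v ∷ u ∷ us) → Adj G (last u us) s → penultimate v u us ≢ s →
                       LeafWalk v u
    leafWalk-through {u = u} {us} {s} to-w w~s p≢s =
      leafWalk (us ++ s ∷ rest ℓ) (NBWalk-++ to-w (NBWalk-last-edge to-w ∷⟪ p≢s ⟫ walk ℓ))
               (trans (cong (deg G) (last-++ u us (s ∷ rest ℓ))) (ends-at-leaf ℓ))
      where ℓ = leafWalk-from w~s

    -- The leg through w continues via s; the extra branch at w leaves via y, so it shares no edge with any leg.
    module ExtraBranch {v u us s y} (to-w : NBWalk (v ∷ u ∷ us))
                       (w~s : Adj G (last u us) s) (w~y : Adj G (last u us) y)
                       (p≢s : penultimate v u us ≢ s) (p≢y : penultimate v u us ≢ y) (s≢y : s ≢ y) where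

      w : V
      w = last u us

      ℓy : LeafWalk w y
      ℓy = leafWalk-from w~y

      branch : List V
      branch = w ∷ y ∷ rest ℓy

      legVia : ∀ {u′} → Dec (u′ ≡ u) → Adj G v u′ → LeafWalk v u′
      legVia (yes refl) _    = leafWalk-through to-w w~s p≢s
      legVia (no _)     v~u′ = leafWalk-from v~u′

      leg : ∀ {u′} → Adj G v u′ → LeafWalk v u′
      leg {u′} = legVia (u′ ≟ᶠ u)

      through-y : NBWalk (v ∷ u ∷ us ++ y ∷ rest ℓy)
      through-y = walk (leafWalk-through to-w w~y p≢y)

      branch⊆through-y : z ∈ branch → z ∈ u ∷ us ++ y ∷ rest ℓy
      branch⊆through-y (here refl) = ∈-++⁺ˡ (last-∈ u us)
      branch⊆through-y (there z∈)  = ∈-++⁺ʳ (u ∷ us) z∈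

      through-y! : Unique (v ∷ u ∷ us ++ y ∷ rest ℓy)
      through-y! = NBWalk⇒Unique through-y

      legs-meet-branch-at-w : ∀ {u′} (d : Dec (u′ ≡ u)) (v~u′ : Adj G v u′) →
                              z ∈ v ∷ u′ ∷ rest (legVia d v~u′) → z ∈ branch → z ≡ w
      legs-meet-branch-at-w _ _ _ (here z≡w) = z≡w
      legs-meet-branch-at-w _ _ (here refl) z∈branch with through-y!
      ... | v∉tail ∷ _ = ⊥-elim (All.lookup v∉tail (branch⊆through-y z∈branch) refl)
      legs-meet-branch-at-w (yes refl) _ (there z∈leg) (there z∈y⋯) with ∈-++⁻ (u ∷ us) z∈leg | through-y!
      ... | inj₁ z∈u⋯w | _ ∷ tail! = ⊥-elim (Unique-++⇒Disjoint (u ∷ us) tail! (z∈u⋯w , z∈y⋯))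
      ... | inj₂ z∈s⋯  | _         = ⊥-elim (branches-disjoint (walk (leafWalk-from w~s)) (walk ℓy) s≢y (z∈s⋯ , z∈y⋯))
      legs-meet-branch-at-w (no u′≢u) v~u′ (there z∈leg) z∈branch =
        ⊥-elim (branches-disjoint (walk (leafWalk-from v~u′)) through-y u′≢u (z∈leg , branch⊆through-y z∈branch))

      branch-disjoint-legs : Disjoint (Legs.allLegEdges v leg) (edges branch)
      branch-disjoint-legs (e∈legs , e∈branch) with Legs.∈-allLegEdges⁻ v leg e∈legs
      ... | u′ , v~u′ , e∈leg =
        edges-disjoint (walk (leg v~u′)) (walk ℓy) (legs-meet-branch-at-w (u′ ≟ᶠ u) v~u′) (e∈leg , e∈branch)

      branch-weight>0 : 0 < sum (map weight (edges branch))
      branch-weight>0 = begin-strict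
        0                               <⟨ s≤s z≤n ⟩
        3 * 3 ∸ 1                       ≤⟨ ∸-monoˡ-≤ 1 (*-mono-≤ 3≤deg 3≤deg) ⟩
        deg² w ∸ 1                      ≤⟨ leafWalk-variation-≥ ℓy ⟩
        variation deg² branch           ≡⟨ sum-weight-edges (walk ℓy) ⟨
        sum (map weight (edges branch)) ∎
        where
        open ≤-Reasoning
        3≤deg : 3 ≤ deg G w
        3≤deg = deg≥3 (Adj-sym (NBWalk-last-edge to-w)) w~s w~y p≢s p≢y s≢y

      FWI*-> : starBound v < FWI* G
      FWI*-> = <-≤-trans (m<m+n _ branch-weight>0)
        (Legs.FWI*-≥-legs+extra v leg (edges-unique (walk ℓy) (NBWalk⇒Unique (walk ℓy))) branch-disjoint-legs)

    module Tree (connected : Connected G) where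

      FWI*-> : ∀ v {w} → w ≢ v → 2 < deg G w → starBound v < FWI* G
      FWI*-> v {w} w≢v 3≤deg with walk⇒NBWalk (connected v w)
      ... | []     , _    , refl = ⊥-elim (w≢v refl)
      ... | u ∷ us , to-w , refl with neighbour-≢ (≤-trans (n≤1+n 2) 3≤deg) (penultimate v u us)
      ...   | s , w~s , s≢p with neighbour-≢₂ 3≤deg (penultimate v u us) s
      ...     | y , w~y , y≢p , y≢s = ExtraBranch.FWI*-> to-w w~s w~y (s≢p ∘′ sym) (y≢p ∘′ sym) (y≢s ∘′ sym)

      FWI*-≤-starlike : ∀ {v} → (∀ x → deg G x ≤ deg G v) → StarlikeAt v → FWI* G ≤ starBound v
      FWI*-≤-starlike {v} maximal starlike = begin
        FWI* G                                                   ≤⟨ FWI*≤sum covered ⟩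
        sum (map weight allLegEdges)                             ≡⟨ sum-allLegEdges ⟩
        sum (map legWeight (allFin n))                           ≤⟨ sum-map-mono legWeight (allFin n) legWeight-≤ ⟩
        sum (map (λ u → adjCount v u * (deg² v ∸ 1)) (allFin n)) ≡⟨ sum-map-*ʳ (adjCount v) _ (allFin n) ⟨
        starBound v                                              ∎
        where
        open ≤-Reasoning
        open Legs v leafWalk-from

        legWeight-≤ : ∀ u → legWeight u ≤ adjCount v u * (deg² v ∸ 1)
        legWeight-≤ u with Adj? v u
        ... | no _    = z≤n
        ... | yes v~u = ≤-reflexive (begin-equality
          sum (map weight (edges (v ∷ u ∷ rest ℓ))) ≡⟨ sum-weight-edges (walk ℓ) ⟩
          variation deg² (v ∷ u ∷ rest ℓ)           ≡⟨ leafWalk-variation-≡ ℓ (maximal u) (leafWalk-tail-≤2 starlike ℓ) ⟩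
          deg² v ∸ 1                                ≡⟨ *-identityˡ _ ⟨
          1 * (deg² v ∸ 1)                          ≡⟨ cong (_* (deg² v ∸ 1)) (adjCount-Adj v~u) ⟨
          adjCount v u * (deg² v ∸ 1)               ∎)
          where ℓ = leafWalk-from v~u

        -- Every edge lies on a non-backtracking walk from v, which cannot leave the leg it starts along.
        covered : ∀ {a b} → Adj G a b → edge a b ∈ allLegEdges
        covered {a} {b} a~b with edge-on-NBWalk-from connected v a~b
        ... | u , ys , w , e∈ = ∈-allLegEdges⁺ (NBWalk-head w) λ v~u →
          let ℓ = leafWalk-from v~u
              zs , rest≡ = prefix-of-leafWalk ℓ (leafWalk-tail-≤2 starlike ℓ) w
          in subst (λ r → edge a b ∈ edges (v ∷ u ∷ r)) (sym rest≡) (edges-++⁺ˡ v (u ∷ ys) e∈)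

      leafWalk-covers : ∀ {ℓ p} → deg G ℓ ≡ 1 → (∀ x → deg G x ≤ 2) → (spine : LeafWalk ℓ p) →
                        ∀ z → z ∈ ℓ ∷ p ∷ rest spine
      leafWalk-covers {ℓ} {p} leaf small spine z with walk⇒NBWalk (connected ℓ z)
      ... | []     , _ , refl = here refl
      ... | c ∷ cs , w , refl with c ≟ᶠ p
      ...   | no c≢p   = ⊥-elim (1+n≰n (subst (2 ≤_) leaf (deg≥2 (NBWalk-head w) (NBWalk-head (walk spine)) c≢p)))
      ...   | yes refl =
        let zs , rest≡ = prefix-of-leafWalk spine (All.universal small _) w
        in there (subst (λ r → last c cs ∈ c ∷ r) (sym rest≡) (∈-++⁺ˡ (last-∈ c cs)))

      deg≤2⇒IsPath : V → (∀ x → deg G x ≤ 2) → IsPath G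
      deg≤2⇒IsPath x small with deg G x ≟ 0
      ... | yes isolated = path-listing⇒IsPath [-] ([] ∷ []) only-x
        where
        only-x : ∀ z → z ∈ [ x ]
        only-x z with connected x z
        ... | here         = here refl
        ... | step x~y _ = ⊥-elim (1+n≰n (subst (1 ≤_) isolated (deg≥1 x~y)))
      ... | no ¬isolated with neighbour (n≢0⇒n>0 ¬isolated)
      ...   | u , x~u =
        path-listing⇒IsPath (walk spine) (NBWalk⇒Unique (walk spine)) (leafWalk-covers (ends-at-leaf ℓ₀) small spine)
        where
        ℓ₀ = leafWalk-from x~u
        spine = leafWalk-from (Adj-sym (NBWalk-last-edge (walk ℓ₀)))

      FWI*≡starBound : ∀ {v} → (∀ x → deg G x ≤ deg G v) → StarlikeAt v → FWI* G ≡ starBound v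
      FWI*≡starBound {v} maximal starlike = ≤-antisym (FWI*-≤-starlike maximal starlike) (FWI*-≥ v)

      starlike⇒shape : ∀ {v} → StarlikeAt v → IsPath G ⊎ ExactlyOneBig G
      starlike⇒shape {v} starlike with deg G v ≤? 2
      ... | yes v≤2 = inj₁ (deg≤2⇒IsPath v (starlike-deg≤2 starlike v≤2))
      ... | no v≰2  = inj₂ (v , ≰⇒> v≰2 , λ _ → starlike-unique-big starlike)

proposition3 : (n : ℕ) (T : Graph n) → IsTree T →
    (Δ T * (Δ T * Δ T ∸ 1) ≤ FWI* T) ×
    ((FWI* T ≡ Δ T * (Δ T * Δ T ∸ 1)) ⇔ (IsPath T ⊎ ExactlyOneBig T))
proposition3 zero    T (() , _)
proposition3 (suc m) T (_ , connected , acyclic) = lower-bound , mk⇔ equality⇒shape shape⇒equality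
  where
  open GraphTheory T
  open Acyclic acyclic
  open Tree connected

  v : V
  v = proj₁ (Δ-attained fzero)

  bound≡ : starBound v ≡ Δ T * (Δ T * Δ T ∸ 1)
  bound≡ = cong (λ d → d * (d * d ∸ 1)) (proj₂ (Δ-attained fzero))

  maximal : ∀ x → deg T x ≤ deg T v
  maximal x = subst (deg T x ≤_) (sym (proj₂ (Δ-attained fzero))) (deg≤Δ x)

  lower-bound : Δ T * (Δ T * Δ T ∸ 1) ≤ FWI* T
  lower-bound = subst (_≤ FWI* T) bound≡ (FWI*-≥ v)

  equality⇒shape : FWI* T ≡ Δ T * (Δ T * Δ T ∸ 1) → IsPath T ⊎ ExactlyOneBig T
  equality⇒shape FWI*≡ with starlike? v
  ... | inj₁ starlike        = starlike⇒shape starlike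
  ... | inj₂ (w , w≢v , 2<w) = ⊥-elim (<-irrefl (trans bound≡ (sym FWI*≡)) (FWI*-> v w≢v 2<w))

  shape⇒equality : IsPath T ⊎ ExactlyOneBig T → FWI* T ≡ Δ T * (Δ T * Δ T ∸ 1)
  shape⇒equality shape = trans (FWI*≡starBound maximal (shape⇒starlike maximal shape)) bound≡
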